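{- Let $N>1$ be an integer and let $v=2^N$. For $1\le i\le N$ let $A_i\subseteq \mathbb{Z}_{2^N}$ be the set of $t\in\{0,1,\ldots,2^N-1\}$ such that $t \bmod 2^i\in\{0,1,\ldots,2^{i-1}-1\}$ (equivalently, the support of the length-$2^N$ binary sequence consisting of $2^{i-1}$ ones followed by $2^{i-1}$ zeros, this length-$2^i$ pattern repeated $2^{N-i}$ times). Then $\{A_1,\ldots,A_N\}$ is a $(2^N,N,2^{N-1},2^{N-2})$-PSEDF in $\mathbb{Z}_{2^N}$. In particular, there exists a $(2^N,N,2^{N-1},2^{N-2})$-PSEDF in $\mathbb{Z}_{2^N}$.
   Context: Groups are written additively. For subsets $A,B$ of a group $G$, $\Delta(A,B)$ denotes the multiset $\{a-b: a\in A, b\in B\}$. For a group $G$ of order $v$ and $m>1$, a family of $k$-subsets $\{A_1,\ldots,A_m\}$ of $G$ is a $(v,m,k,\lambda)$-PSEDF if for every pair $i\neq j$ ($1\le i,j\le m$) the multiset $\Delta(A_i,A_j)$ contains every element of $G$ exactly $\lambda$ times. -}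

module Defs where

open import Data.Nat using (ℕ; suc; _+_; _∸_; _^_; _<_; _<?_; NonZero)
open import Data.Nat.Properties using (m^n≢0)
open import Data.Nat.DivMod using (_%_; m%n<n)
open import Data.Fin using (Fin; toℕ; fromℕ<)
open import Data.Fin.Subset using (Subset; _∈_; ∣_∣)
open import Data.Fin.Subset.Properties using (_∈?_)
open import Data.Fin.Properties using (_≟_)
open import Data.Vec using (tabulate)
open import Data.List using (List; filter; length; allFin; cartesianProduct)
open import Data.Product using (_×_; _,_; proj₁; proj₂)
open import Relation.Nullary using (¬_; does)
open import Relation.Binary.PropositionalEquality using (_≡_)

_⊖_ : ∀ {v} .{{_ : NonZero v}} → Fin v → Fin v → Fin v
_⊖_ {v} a b = fromℕ< (m%n<n (toℕ a + (v ∸ toℕ b)) v)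

elems : ∀ {v} → Subset v → List (Fin v)
elems A = filter (λ x → x ∈? A) (allFin _)

Δmult : ∀ {v} .{{_ : NonZero v}} → Subset v → Subset v → Fin v → ℕ
Δmult A B g =
  length (filter (λ p → (proj₁ p ⊖ proj₂ p) ≟ g) (cartesianProduct (elems A) (elems B)))

IsPSEDF : (v m k lam : ℕ) .{{_ : NonZero v}} → (Fin m → Subset v) → Set
IsPSEDF v m k lam A =
  (1 < m)
  × (∀ i → ∣ A i ∣ ≡ k)
  × (∀ i j → ¬ (i ≡ j) → ∀ (g : Fin v) → Δmult (A i) (A j) g ≡ lam)

-- A_i for i = 1..N, indexed by j : Fin N with i = j+1:
-- A_i = { t ∈ {0,…,2^N-1} : t mod 2^i < 2^(i-1) }
seqSet : (N : ℕ) → Fin N → Subset (2 ^ N)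
seqSet N j = tabulate (λ t → does ((toℕ t % (2 ^ suc (toℕ j))) {{m^n≢0 2 (suc (toℕ j))}} <? 2 ^ toℕ j))

module Submission where

-- The indicator of A_i is the square wave w_i of half-period 2^(i-1): shifting it by 2^(i-1)
-- complements it.  The multiplicity of g in Δ(A_i, A_j) counts the t with w_i(t) = w_j(t - g) = 1.
-- For i < j put L = 2^(j-1): w_i is L-periodic while t ↦ w_j(t - g) is L-antiperiodic, so of t and
-- t + L exactly one is counted whenever w_i(t) = 1.  Hence the count is
-- (2^N / 2L) · |A_i ∩ [0, L)| = 2^(N-j) · 2^(j-2) = 2^(N-2).

open import Defs
open import Data.Nat using (ℕ; _<_; _∸_; _^_)
open import Data.Nat.Properties using (m^n≢0)
open import Data.Fin using (Fin)
open import Data.Fin.Subset using (Subset)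
open import Data.Product using (_×_; ∃)

open import Data.Bool using (Bool; true; false; not; _∧_; if_then_else_)
open import Data.Bool.Properties using (not-involutive; ∧-comm)
open import Data.Nat using (zero; suc; _+_; _*_; _≤_; s<s⁻¹; NonZero)
open import Data.Nat.Properties
open import Data.Nat.DivMod
open import Data.Nat.Divisibility using (_∣_; divides; ∣-refl)
open import Data.Nat.ListAction using (sum)
open import Data.Fin using (zero; suc; toℕ)
open import Data.Fin.Properties using (toℕ-fromℕ<; toℕ-injective; toℕ<n) renaming (_≟_ to _≟ᶠ_)
open import Data.Fin.Subset using (∣_∣)
open import Data.Fin.Subset.Properties using (_∈?_)
open import Data.List as List using ([]; _∷_; _++_; map; filter; length; cartesianProduct; allFin)
open import Data.List.Properties using (filter-++; length-++; map-cong)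
open import Data.Product using (_,_)
open import Data.Vec using (tabulate)
open import Function using (_∘_; mk⇔)
open import Relation.Binary using (tri<; tri≈; tri>)
open import Relation.Binary.PropositionalEquality
open import Relation.Nullary using (does; yes; no; contradiction)
open import Relation.Nullary.Decidable using (_×-dec_; dec-true; dec-false; does-⇔)
open import Relation.Unary using (Pred; Decidable)

count : ℕ → (ℕ → Bool) → ℕ
count zero    f = 0
count (suc n) f = if f 0 then suc (count n (f ∘ suc)) else count n (f ∘ suc)

Periodic : ℕ → (ℕ → Bool) → Set
Periodic p f = ∀ t → f (p + t) ≡ f t

Antiperiodic : ℕ → (ℕ → Bool) → Set
Antiperiodic L f = ∀ t → f (L + t) ≡ not (f t)

count-cong : ∀ n {f g : ℕ → Bool} → (∀ t → f t ≡ g t) → count n f ≡ count n g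
count-cong zero    f≗g = refl
count-cong (suc n) f≗g rewrite f≗g 0 = cong (λ c → if _ then suc c else c) (count-cong n (f≗g ∘ suc))

count-true : ∀ n → count n (λ _ → true) ≡ n
count-true zero    = refl
count-true (suc n) = cong suc (count-true n)

count-false : ∀ n → count n (λ _ → false) ≡ 0
count-false zero    = refl
count-false (suc n) = count-false n

count-+ : ∀ m n (f : ℕ → Bool) → count (m + n) f ≡ count m f + count n (λ t → f (m + t))
count-+ zero    n f = refl
count-+ (suc m) n f with f 0
... | true  = cong suc (count-+ m n (f ∘ suc))
... | false = count-+ m n (f ∘ suc)

count-∧-split : ∀ n (f h : ℕ → Bool) →
  count n (λ t → f t ∧ h t) + count n (λ t → f t ∧ not (h t)) ≡ count n f
count-∧-split zero    f h = refl
count-∧-split (suc n) f h with f 0 | h 0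
... | false | _     = count-∧-split n (f ∘ suc) (h ∘ suc)
... | true  | true  = cong suc (count-∧-split n (f ∘ suc) (h ∘ suc))
... | true  | false = trans (+-suc _ _) (cong suc (count-∧-split n (f ∘ suc) (h ∘ suc)))

periodic-+ : ∀ {p q f} → Periodic p f → Periodic q f → Periodic (p + q) f
periodic-+ {p} {q} {f} pf qf t = begin
  f (p + q + t)   ≡⟨ cong f (+-assoc p q t) ⟩
  f (p + (q + t)) ≡⟨ pf (q + t) ⟩
  f (q + t)       ≡⟨ qf t ⟩
  f t             ∎
  where open ≡-Reasoning

periodic-* : ∀ k {p f} → Periodic p f → Periodic (k * p) f
periodic-* zero    pf t = refl
periodic-* (suc k) pf   = periodic-+ pf (periodic-* k pf)

periodic-∧ : ∀ {p f h} → Periodic p f → Periodic p h → Periodic p (λ t → f t ∧ h t)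
periodic-∧ pf ph t = cong₂ _∧_ (pf t) (ph t)

antiperiodic⇒periodic : ∀ {L f} → Antiperiodic L f → Periodic (L + L) f
antiperiodic⇒periodic {L} {f} af t = begin
  f (L + L + t)         ≡⟨ cong f (+-assoc L L t) ⟩
  f (L + (L + t))       ≡⟨ af (L + t) ⟩
  not (f (L + t))       ≡⟨ cong not (af t) ⟩
  not (not (f t))       ≡⟨ not-involutive (f t) ⟩
  f t                   ∎
  where open ≡-Reasoning

antiperiodic-shift : ∀ {L f} c → Antiperiodic L f → Antiperiodic L (λ t → f (t + c))
antiperiodic-shift {L} {f} c af t = trans (cong f (+-assoc L t c)) (af (t + c))

count-periodic : ∀ k {p f} → Periodic p f → count (k * p) f ≡ k * count p f
count-periodic zero        pf = refl
count-periodic (suc k) {p} {f} pf = begin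
  count (p + k * p) f                         ≡⟨ count-+ p (k * p) f ⟩
  count p f + count (k * p) (λ t → f (p + t)) ≡⟨ cong (count p f +_) (count-cong (k * p) pf) ⟩
  count p f + count (k * p) f                 ≡⟨ cong (count p f +_) (count-periodic k pf) ⟩
  count p f + k * count p f                   ∎
  where open ≡-Reasoning

count-∧-antiperiodic : ∀ L {f h} → Periodic L f → Antiperiodic L h →
  count (L + L) (λ t → f t ∧ h t) ≡ count L f
count-∧-antiperiodic L {f} {h} pf ah = begin
  count (L + L) (λ t → f t ∧ h t)
    ≡⟨ count-+ L L _ ⟩
  count L (λ t → f t ∧ h t) + count L (λ t → f (L + t) ∧ h (L + t))
    ≡⟨ cong (count L _ +_) (count-cong L (λ t → cong₂ _∧_ (pf t) (ah t))) ⟩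
  count L (λ t → f t ∧ h t) + count L (λ t → f t ∧ not (h t))
    ≡⟨ count-∧-split L f h ⟩
  count L f ∎
  where open ≡-Reasoning

count-antiperiodic : ∀ L {h} → Antiperiodic L h → count (L + L) h ≡ L
count-antiperiodic L ah = trans (count-∧-antiperiodic L (λ _ → refl) ah) (count-true L)

2^[1+m+n]≡2^n*[2^m+2^m] : ∀ m n → 2 ^ (suc m + n) ≡ 2 ^ n * (2 ^ m + 2 ^ m)
2^[1+m+n]≡2^n*[2^m+2^m] m n = begin
  2 ^ (suc m + n)         ≡⟨ ^-distribˡ-+-* 2 (suc m) n ⟩
  2 ^ suc m * 2 ^ n       ≡⟨ *-comm (2 ^ suc m) (2 ^ n) ⟩
  2 ^ n * 2 ^ suc m       ≡⟨ cong (λ k → 2 ^ n * (2 ^ m + k)) (+-identityʳ (2 ^ m)) ⟩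
  2 ^ n * (2 ^ m + 2 ^ m) ∎
  where open ≡-Reasoning

2^n*2^m≡2^[m+n] : ∀ m n → 2 ^ n * 2 ^ m ≡ 2 ^ (m + n)
2^n*2^m≡2^[m+n] m n = trans (*-comm (2 ^ n) (2 ^ m)) (sym (^-distribˡ-+-* 2 m n))

antiperiodic⇒periodic-2^ : ∀ m n {f} → Antiperiodic (2 ^ m) f → Periodic (2 ^ (suc m + n)) f
antiperiodic⇒periodic-2^ m n {f} af =
  subst (λ p → Periodic p f) (sym (2^[1+m+n]≡2^n*[2^m+2^m] m n))
        (periodic-* (2 ^ n) (antiperiodic⇒periodic af))

count-antiperiodic-2^ : ∀ m n {f} → Antiperiodic (2 ^ m) f → count (2 ^ (suc m + n)) f ≡ 2 ^ (m + n)
count-antiperiodic-2^ m n {f} af = begin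
  count (2 ^ (suc m + n)) f         ≡⟨ cong (λ k → count k f) (2^[1+m+n]≡2^n*[2^m+2^m] m n) ⟩
  count (2 ^ n * (2 ^ m + 2 ^ m)) f ≡⟨ count-periodic (2 ^ n) (antiperiodic⇒periodic af) ⟩
  2 ^ n * count (2 ^ m + 2 ^ m) f   ≡⟨ cong (2 ^ n *_) (count-antiperiodic (2 ^ m) af) ⟩
  2 ^ n * 2 ^ m                     ≡⟨ 2^n*2^m≡2^[m+n] m n ⟩
  2 ^ (m + n)                       ∎
  where open ≡-Reasoning

count-∧-antiperiodic-2^ : ∀ m k n {f h} → Antiperiodic (2 ^ m) f → Antiperiodic (2 ^ (suc m + k)) h →
  count (2 ^ (suc (suc m + k) + n)) (λ t → f t ∧ h t) ≡ 2 ^ (m + k + n)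
count-∧-antiperiodic-2^ m k n {f} {h} af ah = begin
  count (2 ^ (suc x + n)) f∧h       ≡⟨ cong (λ p → count p f∧h) (2^[1+m+n]≡2^n*[2^m+2^m] x n) ⟩
  count (2 ^ n * (L + L)) f∧h       ≡⟨ count-periodic (2 ^ n) (periodic-∧ (periodic-+ pf pf) (antiperiodic⇒periodic ah)) ⟩
  2 ^ n * count (L + L) f∧h         ≡⟨ cong (2 ^ n *_) (count-∧-antiperiodic L pf ah) ⟩
  2 ^ n * count L f                 ≡⟨ cong (2 ^ n *_) (count-antiperiodic-2^ m k af) ⟩
  2 ^ n * 2 ^ (m + k)               ≡⟨ 2^n*2^m≡2^[m+n] (m + k) n ⟩
  2 ^ (m + k + n)                   ∎
  where
  open ≡-Reasoning
  x = suc m + k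
  L = 2 ^ x
  f∧h = λ t → f t ∧ h t
  pf : Periodic L f
  pf = antiperiodic⇒periodic-2^ m k af

count-antiperiodic-< : ∀ {x N f} → x < N → Antiperiodic (2 ^ x) f → count (2 ^ N) f ≡ 2 ^ (N ∸ 1)
count-antiperiodic-< {x} x<N af with m≤n⇒∃[o]m+o≡n x<N
... | n , refl = count-antiperiodic-2^ x n af

count-∧-antiperiodic-< : ∀ {y x N f h} → y < x → x < N → Antiperiodic (2 ^ y) f → Antiperiodic (2 ^ x) h →
  count (2 ^ N) (λ t → f t ∧ h t) ≡ 2 ^ (N ∸ 2)
count-∧-antiperiodic-< {y} y<x x<N af ah with m≤n⇒∃[o]m+o≡n y<x
... | k , refl with m≤n⇒∃[o]m+o≡n x<N
...   | n , refl = count-∧-antiperiodic-2^ y k n af ah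

count-∧-antiperiodic-≢ : ∀ {y x N f h} → y ≢ x → y < N → x < N →
  Antiperiodic (2 ^ y) f → Antiperiodic (2 ^ x) h → count (2 ^ N) (λ t → f t ∧ h t) ≡ 2 ^ (N ∸ 2)
count-∧-antiperiodic-≢ {y} {x} {N} {f} {h} y≢x y<N x<N af ah with <-cmp y x
... | tri< y<x _ _ = count-∧-antiperiodic-< y<x x<N af ah
... | tri≈ _ y≡x _ = contradiction y≡x y≢x
... | tri> _ _ x<y = trans (count-cong (2 ^ N) (λ t → ∧-comm (f t) (h t)))
                           (count-∧-antiperiodic-< x<y y<N ah af)

%-cong-+ : ∀ {m m′ k k′ n} .{{_ : NonZero n}} →
  m % n ≡ m′ % n → k % n ≡ k′ % n → (m + k) % n ≡ (m′ + k′) % n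
%-cong-+ {m} {m′} {k} {k′} {n} m≡m′ k≡k′ = begin
  (m + k) % n             ≡⟨ %-distribˡ-+ m k n ⟩
  (m % n + k % n) % n     ≡⟨ cong₂ (λ a b → (a + b) % n) m≡m′ k≡k′ ⟩
  (m′ % n + k′ % n) % n   ≡⟨ %-distribˡ-+ m′ k′ n ⟨
  (m′ + k′) % n           ∎
  where open ≡-Reasoning

m^n∣m^[n+o] : ∀ m n o → m ^ n ∣ m ^ (n + o)
m^n∣m^[n+o] m n o = divides (m ^ o) (trans (^-distribˡ-+-* m n o) (*-comm (m ^ n) (m ^ o)))

lowerHalf-antiperiodic : ∀ L {M} .{{_ : NonZero M}} → M ≡ L + L → ∀ t →
  does ((L + t) % M <? L) ≡ not (does (t % M <? L))
lowerHalf-antiperiodic L {M} refl t = begin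
  does ((L + t) % M <? L)         ≡⟨ cong (λ r → does (r <? L)) (%-cong-+ refl (sym (m%n%n≡m%n t M))) ⟩
  does ((L + t % M) % M <? L)     ≡⟨ lowerHalf-flip (t % M) (m%n<n t M) ⟩
  not (does (t % M <? L))         ∎
  where
  open ≡-Reasoning
  lowerHalf-flip : ∀ r → r < L + L → does ((L + r) % M <? L) ≡ not (does (r <? L))
  lowerHalf-flip r r<M with r <? L
  ... | yes r<L = begin
    does ((L + r) % M <? L) ≡⟨ cong (λ s → does (s <? L)) (m<n⇒m%n≡m (+-monoʳ-< L r<L)) ⟩
    does (L + r <? L)       ≡⟨ dec-false (L + r <? L) (≤⇒≯ (m≤m+n L r)) ⟩
    false                   ≡⟨ cong not (dec-true (r <? L) r<L) ⟨
    not (does (r <? L))     ∎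
  ... | no r≮L with m≤n⇒∃[o]m+o≡n (≮⇒≥ r≮L)
  ...   | s , refl = begin
    does ((L + (L + s)) % M <? L) ≡⟨ cong (λ u → does (u <? L)) L+[L+s]%M≡s ⟩
    does (s <? L)                 ≡⟨ dec-true (s <? L) s<L ⟩
    true                          ≡⟨ cong not (dec-false (L + s <? L) r≮L) ⟨
    not (does (L + s <? L))       ∎
    where
    s<L : s < L
    s<L = +-cancelˡ-< L s L r<M
    L+[L+s]%M≡s : (L + (L + s)) % M ≡ s
    L+[L+s]%M≡s = begin
      (L + (L + s)) % M ≡⟨ cong (_% M) (+-assoc L L s) ⟨
      (M + s) % M       ≡⟨ %-remove-+ˡ s (∣-refl {M}) ⟩
      s % M             ≡⟨ m<n⇒m%n≡m (<-≤-trans s<L (m≤m+n L L)) ⟩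
      s                 ∎

squareWave : ℕ → ℕ → Bool
squareWave j t = does ((t % 2 ^ suc j) {{m^n≢0 2 (suc j)}} <? 2 ^ j)

squareWave-antiperiodic : ∀ j → Antiperiodic (2 ^ j) (squareWave j)
squareWave-antiperiodic j = lowerHalf-antiperiodic (2 ^ j) {{m^n≢0 2 (suc j)}}
                              (cong (2 ^ j +_) (+-identityʳ (2 ^ j)))

squareWave-% : ∀ {j N} → j < N → ∀ t → squareWave j ((t % 2 ^ N) {{m^n≢0 2 N}}) ≡ squareWave j t
squareWave-% {j} j<N t with m≤n⇒∃[o]m+o≡n j<N
... | e , refl = cong (λ r → does (r <? 2 ^ j))
  (m∣n⇒o%n%m≡o%m (2 ^ suc j) (2 ^ (suc j + e)) t {{m^n≢0 2 (suc j)}} {{m^n≢0 2 (suc j + e)}}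
                 (m^n∣m^[n+o] 2 (suc j) e))

[m+[n∸k]+k]%n≡m%n : ∀ m {n k} .{{_ : NonZero n}} → k ≤ n → (m + (n ∸ k) + k) % n ≡ m % n
[m+[n∸k]+k]%n≡m%n m {n} {k} k≤n = trans (cong (λ u → u % n) (trans (+-assoc m (n ∸ k) k) (cong (m +_) (m∸n+n≡m k≤n))))
                                       ([m+n]%n≡m%n m n)

[m+k+[n∸k]]%n≡m%n : ∀ m {n k} .{{_ : NonZero n}} → k ≤ n → (m + k + (n ∸ k)) % n ≡ m % n
[m+k+[n∸k]]%n≡m%n m {n} {k} k≤n = trans (cong (λ u → u % n) (trans (+-assoc m k (n ∸ k)) (cong (m +_) (m+[n∸m]≡n k≤n))))
                                       ([m+n]%n≡m%n m n)

%-+-cancelʳ : ∀ m o {n k} .{{_ : NonZero n}} → k ≤ n → (m + k) % n ≡ (o + k) % n → m % n ≡ o % n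
%-+-cancelʳ m o {n} {k} k≤n eq = begin
  m % n                 ≡⟨ [m+k+[n∸k]]%n≡m%n m k≤n ⟨
  (m + k + (n ∸ k)) % n ≡⟨ %-cong-+ eq refl ⟩
  (o + k + (n ∸ k)) % n ≡⟨ [m+k+[n∸k]]%n≡m%n o k≤n ⟩
  o % n                 ∎
  where open ≡-Reasoning

module _ {v} .{{_ : NonZero v}} where

  toℕ-⊖ : (a b : Fin v) → toℕ (a ⊖ b) ≡ (toℕ a + (v ∸ toℕ b)) % v
  toℕ-⊖ a b = toℕ-fromℕ< _

  ⊖-+ : ∀ (a b : Fin v) → (toℕ (a ⊖ b) + toℕ b) % v ≡ toℕ a % v
  ⊖-+ a b = begin
    (toℕ (a ⊖ b) + toℕ b) % v                    ≡⟨ %-cong-+ (trans (cong (_% v) (toℕ-⊖ a b)) (m%n%n≡m%n _ v)) refl ⟩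
    (toℕ a + (v ∸ toℕ b) + toℕ b) % v            ≡⟨ [m+[n∸k]+k]%n≡m%n (toℕ a) (<⇒≤ (toℕ<n b)) ⟩
    toℕ a % v                                    ∎
    where open ≡-Reasoning

  ⊖-involutive : ∀ (a b : Fin v) → a ⊖ (a ⊖ b) ≡ b
  ⊖-involutive a b = toℕ-injective (begin
    toℕ c     ≡⟨ m<n⇒m%n≡m (toℕ<n c) ⟨
    toℕ c % v ≡⟨ %-+-cancelʳ (toℕ c) (toℕ b) (<⇒≤ (toℕ<n r)) c+r≡b+r ⟩
    toℕ b % v ≡⟨ m<n⇒m%n≡m (toℕ<n b) ⟩
    toℕ b     ∎)
    where
    open ≡-Reasoning
    r = a ⊖ b
    c = a ⊖ r
    c+r≡b+r : (toℕ c + toℕ r) % v ≡ (toℕ b + toℕ r) % v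
    c+r≡b+r = trans (⊖-+ a r) (sym (trans (cong (_% v) (+-comm (toℕ b) (toℕ r))) (⊖-+ a b)))

  does-⊖-≟ : ∀ (a b g : Fin v) → does ((a ⊖ b) ≟ᶠ g) ≡ does (toℕ b ≟ toℕ (a ⊖ g))
  does-⊖-≟ a b g = does-⇔ (mk⇔ (λ eq → cong toℕ (trans (sym (⊖-involutive a b)) (cong (a ⊖_) eq)))
                               (λ eq → trans (cong (a ⊖_) (toℕ-injective eq)) (⊖-involutive a g)))
                          ((a ⊖ b) ≟ᶠ g) (toℕ b ≟ toℕ (a ⊖ g))

length-filter-map : ∀ {a b p} {A : Set a} {B : Set b} {P : Pred B p} (P? : Decidable P) (f : A → B) xs →
  length (filter P? (map f xs)) ≡ length (filter (P? ∘ f) xs)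
length-filter-map P? f []       = refl
length-filter-map P? f (x ∷ xs) with does (P? (f x))
... | true  = cong suc (length-filter-map P? f xs)
... | false = length-filter-map P? f xs

module _ {a} {A : Set a} where

  length-filter-filter : ∀ {p q} {P : Pred A p} {Q : Pred A q} (P? : Decidable P) (Q? : Decidable Q) xs →
    length (filter P? (filter Q? xs)) ≡ length (filter (λ x → Q? x ×-dec P? x) xs)
  length-filter-filter P? Q? []       = refl
  length-filter-filter P? Q? (x ∷ xs) with does (Q? x)
  ... | false = length-filter-filter P? Q? xs
  ... | true with does (P? x)
  ...   | true  = cong suc (length-filter-filter P? Q? xs)
  ...   | false = length-filter-filter P? Q? xs

  sum-map-if : ∀ {p} {P : Pred A p} (P? : Decidable P) xs →
    sum (map (λ x → if does (P? x) then 1 else 0) xs) ≡ length (filter P? xs)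
  sum-map-if P? []       = refl
  sum-map-if P? (x ∷ xs) with does (P? x)
  ... | true  = cong suc (sum-map-if P? xs)
  ... | false = sum-map-if P? xs

  length-filter-tabulate : ∀ {p} {P : Pred A p} (P? : Decidable P) {n} (g : Fin n → A) (f : ℕ → Bool) →
    (∀ i → does (P? (g i)) ≡ f (toℕ i)) → length (filter P? (List.tabulate g)) ≡ count n f
  length-filter-tabulate P? {zero}  g f e = refl
  length-filter-tabulate P? {suc n} g f e rewrite e zero with f 0
  ... | true  = cong suc (length-filter-tabulate P? (g ∘ suc) (f ∘ suc) (e ∘ suc))
  ... | false = length-filter-tabulate P? (g ∘ suc) (f ∘ suc) (e ∘ suc)

  length-filter-cartesianProduct : ∀ {b p} {B : Set b} {P : Pred (A × B) p} (P? : Decidable P) xs ys →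
    length (filter P? (cartesianProduct xs ys)) ≡ sum (map (λ x → length (filter (λ y → P? (x , y)) ys)) xs)
  length-filter-cartesianProduct P? []       ys = refl
  length-filter-cartesianProduct P? (x ∷ xs) ys = begin
    length (filter P? (map (x ,_) ys ++ cartesianProduct xs ys))
      ≡⟨ cong length (filter-++ P? (map (x ,_) ys) _) ⟩
    length (filter P? (map (x ,_) ys) ++ filter P? (cartesianProduct xs ys))
      ≡⟨ length-++ (filter P? (map (x ,_) ys)) ⟩
    length (filter P? (map (x ,_) ys)) + length (filter P? (cartesianProduct xs ys))
      ≡⟨ cong₂ _+_ (length-filter-map P? (x ,_) ys) (length-filter-cartesianProduct P? xs ys) ⟩
    length (filter (λ y → P? (x , y)) ys) + sum (map (λ x → length (filter (λ y → P? (x , y)) ys)) xs) ∎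
    where open ≡-Reasoning

count-singleton : ∀ n k (β : ℕ → Bool) → k < n → count n (λ t → does (t ≟ k) ∧ β t) ≡ (if β k then 1 else 0)
count-singleton (suc n) zero    β _ with β 0
... | true  = cong suc (count-false n)
... | false = count-false n
count-singleton (suc n) (suc k) β k<n = count-singleton n k (β ∘ suc) (s<s⁻¹ k<n)

∈?-tabulate : ∀ {n} (χ : Fin n → Bool) i → does (i ∈? tabulate χ) ≡ χ i
∈?-tabulate χ zero with χ zero
... | true  = refl
... | false = refl
∈?-tabulate χ (suc i) = ∈?-tabulate (χ ∘ suc) i

∣tabulate∣≡count : ∀ n (f : ℕ → Bool) → ∣ tabulate {n = n} (f ∘ toℕ) ∣ ≡ count n f
∣tabulate∣≡count zero    f = refl
∣tabulate∣≡count (suc n) f with f 0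
... | true  = cong suc (∣tabulate∣≡count n (f ∘ suc))
... | false = ∣tabulate∣≡count n (f ∘ suc)

Δmult-tabulate : ∀ {v} .{{_ : NonZero v}} (α β : ℕ → Bool) (g : Fin v) →
  Δmult (tabulate (α ∘ toℕ)) (tabulate (β ∘ toℕ)) g ≡ count v (λ t → α t ∧ β ((t + (v ∸ toℕ g)) % v))
Δmult-tabulate {v} α β g = begin
  Δmult A B g
    ≡⟨ length-filter-cartesianProduct _ (elems A) (elems B) ⟩
  sum (map (λ a → length (filter (λ b → (a ⊖ b) ≟ᶠ g) (elems B))) (elems A))
    ≡⟨ cong sum (map-cong fibre (elems A)) ⟩
  sum (map (λ a → if does ((a ⊖ g) ∈? B) then 1 else 0) (elems A))
    ≡⟨ sum-map-if (λ a → (a ⊖ g) ∈? B) (elems A) ⟩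
  length (filter (λ a → (a ⊖ g) ∈? B) (elems A))
    ≡⟨ length-filter-filter _ _ (allFin v) ⟩
  length (filter (λ a → a ∈? A ×-dec (a ⊖ g) ∈? B) (allFin v))
    ≡⟨ length-filter-tabulate _ (λ a → a) _ (λ a → cong₂ _∧_ (∈?-tabulate _ a)
         (trans (∈?-tabulate _ (a ⊖ g)) (cong β (toℕ-⊖ a g)))) ⟩
  count v (λ t → α t ∧ β ((t + (v ∸ toℕ g)) % v)) ∎
  where
  open ≡-Reasoning
  A = tabulate (α ∘ toℕ)
  B = tabulate (β ∘ toℕ)
  -- a ⊖ b ≡ g has the single solution b = a ⊖ g.
  fibre : ∀ a → length (filter (λ b → (a ⊖ b) ≟ᶠ g) (elems B)) ≡ (if does ((a ⊖ g) ∈? B) then 1 else 0)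
  fibre a = begin
    length (filter (λ b → (a ⊖ b) ≟ᶠ g) (elems B))
      ≡⟨ length-filter-filter _ _ (allFin v) ⟩
    length (filter (λ b → b ∈? B ×-dec (a ⊖ b) ≟ᶠ g) (allFin v))
      ≡⟨ length-filter-tabulate _ (λ b → b) _ (λ b → trans (cong₂ _∧_ (∈?-tabulate _ b) (does-⊖-≟ a b g))
                                                           (∧-comm (β (toℕ b)) _)) ⟩
    count v (λ t → does (t ≟ toℕ (a ⊖ g)) ∧ β t)
      ≡⟨ count-singleton v (toℕ (a ⊖ g)) β (toℕ<n (a ⊖ g)) ⟩
    (if β (toℕ (a ⊖ g)) then 1 else 0)
      ≡⟨ cong (λ x → if x then 1 else 0) (∈?-tabulate _ (a ⊖ g)) ⟨
    (if does ((a ⊖ g) ∈? B) then 1 else 0) ∎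

module _ (N : ℕ) where

  private instance
    2^N≢0 : NonZero (2 ^ N)
    2^N≢0 = m^n≢0 2 N

  ∣seqSet∣ : ∀ i → ∣ seqSet N i ∣ ≡ 2 ^ (N ∸ 1)
  ∣seqSet∣ i = trans (∣tabulate∣≡count (2 ^ N) (squareWave (toℕ i)))
                     (count-antiperiodic-< (toℕ<n i) (squareWave-antiperiodic (toℕ i)))

  Δmult-seqSet : ∀ i j → i ≢ j → ∀ g → Δmult (seqSet N i) (seqSet N j) g ≡ 2 ^ (N ∸ 2)
  Δmult-seqSet i j i≢j g = begin
    Δmult (seqSet N i) (seqSet N j) g
      ≡⟨ Δmult-tabulate (squareWave (toℕ i)) (squareWave (toℕ j)) g ⟩
    count (2 ^ N) (λ t → squareWave (toℕ i) t ∧ squareWave (toℕ j) ((t + c) % 2 ^ N))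
      ≡⟨ count-cong (2 ^ N) (λ t → cong (squareWave (toℕ i) t ∧_) (squareWave-% (toℕ<n j) (t + c))) ⟩
    count (2 ^ N) (λ t → squareWave (toℕ i) t ∧ squareWave (toℕ j) (t + c))
      ≡⟨ count-∧-antiperiodic-≢ (i≢j ∘ toℕ-injective) (toℕ<n i) (toℕ<n j) (squareWave-antiperiodic (toℕ i))
                                 (antiperiodic-shift c (squareWave-antiperiodic (toℕ j))) ⟩
    2 ^ (N ∸ 2) ∎
    where
    open ≡-Reasoning
    c = 2 ^ N ∸ toℕ g

mainTheorem1 : (N : ℕ) → 1 < N →
    IsPSEDF (2 ^ N) N (2 ^ (N ∸ 1)) (2 ^ (N ∸ 2)) {{m^n≢0 2 N}} (seqSet N)
    × ∃ (λ (A : Fin N → Subset (2 ^ N)) → IsPSEDF (2 ^ N) N (2 ^ (N ∸ 1)) (2 ^ (N ∸ 2)) {{m^n≢0 2 N}} A)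
mainTheorem1 N 1<N = psedf , seqSet N , psedf
  where
  psedf : IsPSEDF (2 ^ N) N (2 ^ (N ∸ 1)) (2 ^ (N ∸ 2)) {{m^n≢0 2 N}} (seqSet N)
  psedf = 1<N , ∣seqSet∣ N , Δmult-seqSet N
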